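{- Let $p,q$ be positive integers. Then: (a) In $\Gamma^{p, q}(i, j_1, -i, j_2)$, the subgroups $\langle \sigma_2^{j_1-1} \rangle$ and $\langle \sigma_2^{j_2+1} \rangle$ are identical and normal. (b) In $\Gamma^{p, q}(i_1, j, i_2, -j)$, the subgroups $\langle \sigma_1^{i_1+1} \rangle$ and $\langle \sigma_1^{i_2-1} \rangle$ are identical and normal. (c) The group $\Gamma^{p, q}(-1, 1, 1, -1)$ is tight. (d) For any integer $i$, the group $\Gamma^{p, q}(i, 1, -i, -1)$ is tight. (e) For any integers $i$, $j_1$, $j_2$, the group $\Gamma^{p, q}(i, j_1, -i, j_2)$ is tight.
   Context: For integers $p,q,i_1,j_1,i_2,j_2$, $\Gamma^{p,q}(i_1,j_1,i_2,j_2)$ denotes the group with presentation $\langle \sigma_1,\sigma_2 \mid \sigma_1^p=\sigma_2^q=(\sigma_1\sigma_2)^2=1,\ \sigma_2^{ -1}\sigma_1=\sigma_1^{i_1}\sigma_2^{j_1},\ \sigma_2\sigma_1^{ -1}=\sigma_1^{i_2}\sigma_2^{j_2}\rangle$. A group $\langle\sigma_1,\sigma_2\rangle$ with two distinguished generators is tight if $\langle\sigma_1,\sigma_2\rangle=\langle\sigma_1\rangle\langle\sigma_2\rangle$. -}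

module Defs where

open import Data.Nat using (ℕ; zero; suc)
open import Data.Integer using (ℤ; +_; -[1+_])
open import Data.Product using (Σ; ∃; _×_)
open import Function.Bundles using (_⇔_)

data Gen : Set where
  σ₁ σ₂ : Gen

infixl 7 _·_
data Word : Set where
  gen : Gen → Word
  e   : Word
  _·_ : Word → Word → Word
  inv : Word → Word

powℕ : Word → ℕ → Word
powℕ w zero    = e
powℕ w (suc n) = w · powℕ w n

pow : Word → ℤ → Word
pow w (+ n)     = powℕ w n
pow w -[1+ n ]  = powℕ (inv w) (suc n)

s1 s2 : Word
s1 = gen σ₁
s2 = gen σ₂

-- The group Γ^{p,q}(i₁,j₁,i₂,j₂) given by its presentation
--   ⟨ σ₁, σ₂ | σ₁^p = σ₂^q = (σ₁σ₂)^2 = 1,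
--              σ₂⁻¹σ₁ = σ₁^{i₁}σ₂^{j₁}, σ₂σ₁⁻¹ = σ₁^{i₂}σ₂^{j₂} ⟩
-- realised as words modulo the congruence generated by the group
-- axioms and the defining relations (equality in the presented group).
module Γ (p q : ℕ) (i₁ j₁ i₂ j₂ : ℤ) where
  infix 4 _≈_
  data _≈_ : Word → Word → Set where
    ≈-refl  : ∀ {x} → x ≈ x
    ≈-sym   : ∀ {x y} → x ≈ y → y ≈ x
    ≈-trans : ∀ {x y z} → x ≈ y → y ≈ z → x ≈ z
    ·-cong  : ∀ {x x′ y y′} → x ≈ x′ → y ≈ y′ → x · y ≈ x′ · y′
    inv-cong : ∀ {x y} → x ≈ y → inv x ≈ inv y
    assoc   : ∀ x y z → (x · y) · z ≈ x · (y · z)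
    idˡ     : ∀ x → e · x ≈ x
    idʳ     : ∀ x → x · e ≈ x
    invˡ    : ∀ x → inv x · x ≈ e
    invʳ    : ∀ x → x · inv x ≈ e
    rel-p   : powℕ s1 p ≈ e
    rel-q   : powℕ s2 q ≈ e
    rel-2   : powℕ (s1 · s2) 2 ≈ e
    rel-1   : inv s2 · s1 ≈ pow s1 i₁ · pow s2 j₁
    rel-2′  : s2 · inv s1 ≈ pow s1 i₂ · pow s2 j₂

  _∈⟨_⟩ : Word → Word → Set
  x ∈⟨ g ⟩ = ∃ λ (k : ℤ) → x ≈ pow g k

  SameSubgroup : Word → Word → Set
  SameSubgroup g h = ∀ x → (x ∈⟨ g ⟩) ⇔ (x ∈⟨ h ⟩)

  NormalCyclic : Word → Set
  NormalCyclic g = ∀ w x → x ∈⟨ g ⟩ → (w · x · inv w) ∈⟨ g ⟩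

  Tight : Set
  Tight = ∀ w → ∃ λ (a : ℤ) → ∃ λ (b : ℤ) → w ≈ pow s1 a · pow s2 b

-- The relations of Γ^{p,q}(i, j₁, -i, j₂) give σ₁ σ₂^{1-j₁} σ₁⁻¹ = σ₂^{j₂+1}. Conjugate elements have
-- the same order, and in the finite cyclic group ⟨σ₂⟩ elements of the same order generate the same
-- subgroup N; N is then normalised by σ₁ and by σ₂, hence normal, which is (a). Part (b) is the same
-- argument with σ₂⁻¹ conjugating σ₁^{1-i₂} to σ₁^{i₁+1}.
-- For (e), the rules σ₂σ₁ = σ₁⁻¹σ₂⁻¹ and σ₂⁻¹σ₁ = σ₁^i σ₂ σ₂^{j₁-1}, with σ₂^{j₁-1} ∈ N, move
-- σ₂σ₁ᵏ (by induction on k) into a coset σ₁^a σ₂^{±1} N ⊆ ⟨σ₁⟩⟨σ₂⟩; since σ₁ and σ₂ have finite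
-- order this makes every element a product σ₁^a σ₂^b. Parts (c) and (d) are instances of (e).
-- Orders need not be computable in a presented group, so "same order" is phrased through annihilating
-- exponents, and membership in ⟨σ₂^d⟩ is obtained by a gcd descent on a known exponent of σ₂.
module Submission where

open import Defs
open import Level using (0ℓ; _⊔_) renaming (suc to lsuc)
open import Algebra.Bundles using (Group)
open import Algebra.Structures using (IsGroup)
import Algebra.Properties.Group as GroupProperties
import Algebra.Properties.CommutativeSemigroup as CommSemigroupProperties
open import Data.Nat as ℕ using (ℕ; zero; suc; _<_; NonZero; ≢-nonZero⁻¹)
import Data.Nat.Properties as ℕ
open import Data.Nat.Divisibility using (_∣_; divides; _∣?_; ∣⇒≤; *-cancelˡ-∣)
open import Data.Nat.GCD using (gcd; gcd-GCD; module Bézout; gcd[m,n]∣m; gcd[m,n]∣n; gcd[m,n]≢0)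
open import Data.Nat.Induction using (<-wellFounded)
open import Data.Integer as ℤ using (ℤ; +_; -[1+_]; -_; _+_; _-_)
import Data.Integer.Properties as ℤ
open import Data.Integer.Tactic.RingSolver using (solve-∀)
open import Data.Product using (∃; _×_; _,_; proj₁; proj₂)
open import Data.Sum using (_⊎_; inj₁; inj₂)
open import Function.Bundles using (_⇔_; mk⇔; Equivalence)
open import Function.Construct.Symmetry using (⇔-sym)
open import Function.Construct.Composition using (_⇔-∘_)
open import Induction.WellFounded using (Acc; acc)
open import Relation.Binary.Core using (Rel)
open import Relation.Binary.PropositionalEquality as ≡ using (_≡_)
open import Relation.Nullary using (yes; no; contradiction)

record WordGroup ℓ : Set (lsuc ℓ) where
  infix 4 _≈_
  field
    _≈_     : Rel Word ℓ
    isGroup : IsGroup _≈_ _·_ e inv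

  group : Group 0ℓ ℓ
  group = record { isGroup = isGroup }

private
  module ℕ-CommSemigroup = CommSemigroupProperties ℕ.*-commutativeSemigroup

module WordGroupProperties {ℓ} (G : WordGroup ℓ) where

  open WordGroup G
  open IsGroup isGroup
  open GroupProperties group
    using (inverseˡ-unique; inverseʳ-unique; ⁻¹-involutive; ⁻¹-anti-homo-∙; ε⁻¹≈ε;
           \\-leftDividesˡ; \\-leftDividesʳ; //-rightDividesʳ)
  open import Algebra.Solver.Monoid (Group.monoid group) using (solve; _⊜_; _⊕_)
  open import Relation.Binary.Reasoning.Setoid setoid

  conj-cong : ∀ c {x y} → x ≈ y → c · x · inv c ≈ c · y · inv c
  conj-cong c x≈y = ∙-congʳ (∙-congˡ x≈y)

  conj-ε : ∀ c → c · e · inv c ≈ e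
  conj-ε c = trans (∙-congʳ (identityʳ c)) (inverseʳ c)

  conj-· : ∀ c x y → c · (x · y) · inv c ≈ (c · x · inv c) · (c · y · inv c)
  conj-· c x y = begin
    c · (x · y) · inv c                ≈⟨ conj-cong c (∙-congʳ (sym (identityʳ x))) ⟩
    c · (x · e · y) · inv c            ≈⟨ conj-cong c (∙-congʳ (∙-congˡ (sym (inverseˡ c)))) ⟩
    c · (x · (inv c · c) · y) · inv c  ≈⟨ solve 4 (λ c x c′ y → (c ⊕ ((x ⊕ (c′ ⊕ c)) ⊕ y)) ⊕ c′
                                            ⊜ ((c ⊕ x) ⊕ c′) ⊕ ((c ⊕ y) ⊕ c′)) refl c x (inv c) y ⟩
    (c · x · inv c) · (c · y · inv c) ∎

  conj-∘ : ∀ c d x → (c · d) · x · inv (c · d) ≈ c · (d · x · inv d) · inv c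
  conj-∘ c d x = begin
    (c · d) · x · inv (c · d)      ≈⟨ ∙-congˡ (⁻¹-anti-homo-∙ c d) ⟩
    (c · d) · x · (inv d · inv c)  ≈⟨ solve 5 (λ c d x d′ c′ → ((c ⊕ d) ⊕ x) ⊕ (d′ ⊕ c′) ⊜ (c ⊕ ((d ⊕ x) ⊕ d′)) ⊕ c′)
                                        refl c d x (inv d) (inv c) ⟩
    c · (d · x · inv d) · inv c ∎

  conj-inv : ∀ c x → c · inv x · inv c ≈ inv (c · x · inv c)
  conj-inv c x = inverseʳ-unique _ _ (begin
    (c · x · inv c) · (c · inv x · inv c)  ≈⟨ sym (conj-· c x (inv x)) ⟩
    c · (x · inv x) · inv c                ≈⟨ conj-cong c (inverseʳ x) ⟩
    c · e · inv c                          ≈⟨ conj-ε c ⟩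
    e ∎)

  conj-flip : ∀ {c x y} → c · x · inv c ≈ y → inv c · y · inv (inv c) ≈ x
  conj-flip {c} {x} {y} cxc⁻¹≈y = begin
    inv c · y · inv (inv c)          ≈⟨ ∙-cong (∙-congˡ (sym cxc⁻¹≈y)) (⁻¹-involutive c) ⟩
    inv c · (c · x · inv c) · c      ≈⟨ solve 3 (λ c′ c x → ((c′ ⊕ ((c ⊕ x) ⊕ c′)) ⊕ c) ⊜ (c′ ⊕ c) ⊕ (x ⊕ (c′ ⊕ c)))
                                          refl (inv c) c x ⟩
    (inv c · c) · (x · (inv c · c))  ≈⟨ ∙-cong (inverseˡ c) (∙-congˡ (inverseˡ c)) ⟩
    e · (x · e)                      ≈⟨ trans (identityˡ _) (identityʳ x) ⟩
    x ∎

  powℕ-cong : ∀ {v w} n → v ≈ w → powℕ v n ≈ powℕ w n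
  powℕ-cong zero    v≈w = refl
  powℕ-cong (suc n) v≈w = ∙-cong v≈w (powℕ-cong n v≈w)

  powℕ-ε : ∀ n → powℕ e n ≈ e
  powℕ-ε zero    = refl
  powℕ-ε (suc n) = trans (identityˡ _) (powℕ-ε n)

  powℕ-+ : ∀ w m n → powℕ w (m ℕ.+ n) ≈ powℕ w m · powℕ w n
  powℕ-+ w zero    n = sym (identityˡ _)
  powℕ-+ w (suc m) n = trans (∙-congˡ (powℕ-+ w m n)) (sym (assoc _ _ _))

  powℕ-* : ∀ w m n → powℕ w (m ℕ.* n) ≈ powℕ (powℕ w n) m
  powℕ-* w zero    n = refl
  powℕ-* w (suc m) n = trans (powℕ-+ w n (m ℕ.* n)) (∙-congˡ (powℕ-* w m n))

  powℕ-sucʳ : ∀ w n → powℕ w (suc n) ≈ powℕ w n · w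
  powℕ-sucʳ w n = begin
    powℕ w (suc n)      ≡⟨ ≡.cong (powℕ w) (ℕ.+-comm 1 n) ⟩
    powℕ w (n ℕ.+ 1)    ≈⟨ powℕ-+ w n 1 ⟩
    powℕ w n · (w · e)  ≈⟨ ∙-congˡ (identityʳ w) ⟩
    powℕ w n · w ∎

  ·powℕ-sucʳ : ∀ x w n → x · powℕ w n · w ≈ x · powℕ w (suc n)
  ·powℕ-sucʳ x w n = trans (assoc x _ w) (∙-congˡ (sym (powℕ-sucʳ w n)))

  powℕ-inv : ∀ w n → inv (powℕ w n) ≈ powℕ (inv w) n
  powℕ-inv w zero    = ε⁻¹≈ε
  powℕ-inv w (suc n) = begin
    inv (w · powℕ w n)      ≈⟨ ⁻¹-anti-homo-∙ w (powℕ w n) ⟩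
    inv (powℕ w n) · inv w  ≈⟨ ∙-congʳ (powℕ-inv w n) ⟩
    powℕ (inv w) n · inv w  ≈⟨ sym (powℕ-sucʳ (inv w) n) ⟩
    powℕ (inv w) (suc n) ∎

  powℕ-conj : ∀ c w n → c · powℕ w n · inv c ≈ powℕ (c · w · inv c) n
  powℕ-conj c w zero    = conj-ε c
  powℕ-conj c w (suc n) = trans (conj-· c w (powℕ w n)) (∙-congˡ (powℕ-conj c w n))

  pow-suc : ∀ w z → pow w (+ 1 + z) ≈ w · pow w z
  pow-suc w (+ n)            = refl
  pow-suc w -[1+ zero ]      = sym (\\-leftDividesˡ w e)
  pow-suc w -[1+ suc n ]     = sym (\\-leftDividesˡ w _)

  pow-pred : ∀ w z → pow w (-[1+ 0 ] + z) ≈ inv w · pow w z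
  pow-pred w (+ zero)  = refl
  pow-pred w (+ suc n) = sym (\\-leftDividesʳ w _)
  pow-pred w -[1+ n ]  = refl

  pow-+ : ∀ w a b → pow w (a + b) ≈ pow w a · pow w b
  pow-+ w (+ zero) b = trans (reflexive (≡.cong (pow w) (ℤ.+-identityˡ b))) (sym (identityˡ _))
  pow-+ w (+ suc n) b = begin
    pow w (+ suc n + b)       ≡⟨ ≡.cong (pow w) (ℤ.+-assoc (+ 1) (+ n) b) ⟩
    pow w (+ 1 + (+ n + b))   ≈⟨ pow-suc w (+ n + b) ⟩
    w · pow w (+ n + b)       ≈⟨ ∙-congˡ (pow-+ w (+ n) b) ⟩
    w · (powℕ w n · pow w b)  ≈⟨ assoc w _ _ ⟨
    powℕ w (suc n) · pow w b ∎
  pow-+ w -[1+ zero ] b = trans (pow-pred w b) (∙-congʳ (sym (identityʳ _)))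
  pow-+ w -[1+ suc n ] b = begin
    pow w (-[1+ suc n ] + b)            ≡⟨ ≡.cong (pow w) (ℤ.+-assoc -[1+ 0 ] -[1+ n ] b) ⟩
    pow w (-[1+ 0 ] + (-[1+ n ] + b))   ≈⟨ pow-pred w (-[1+ n ] + b) ⟩
    inv w · pow w (-[1+ n ] + b)        ≈⟨ ∙-congˡ (pow-+ w -[1+ n ] b) ⟩
    inv w · (pow w -[1+ n ] · pow w b)  ≈⟨ assoc (inv w) _ _ ⟨
    pow w -[1+ suc n ] · pow w b ∎

  pow-neg : ∀ w a → pow w (- a) ≈ inv (pow w a)
  pow-neg w a = inverseˡ-unique _ _ (begin
    pow w (- a) · pow w a  ≈⟨ pow-+ w (- a) a ⟨
    pow w (- a + a)        ≡⟨ ≡.cong (pow w) (ℤ.+-inverseˡ a) ⟩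
    e ∎)

  pow-*ℕ : ∀ w a n → pow w (a ℤ.* + n) ≈ powℕ (pow w a) n
  pow-*ℕ w a zero    = reflexive (≡.cong (pow w) (ℤ.*-zeroʳ a))
  pow-*ℕ w a (suc n) = begin
    pow w (a ℤ.* + suc n)        ≡⟨ ≡.cong (pow w) (ℤ.*-suc a (+ n)) ⟩
    pow w (a + a ℤ.* + n)        ≈⟨ pow-+ w a (a ℤ.* + n) ⟩
    pow w a · pow w (a ℤ.* + n)  ≈⟨ ∙-congˡ (pow-*ℕ w a n) ⟩
    powℕ (pow w a) (suc n) ∎

  pow-* : ∀ w a b → pow w (a ℤ.* b) ≈ pow (pow w a) b
  pow-* w a (+ n)      = pow-*ℕ w a n
  pow-* w a -[1+ n ]   = begin
    pow w (a ℤ.* -[1+ n ])        ≡⟨ ≡.cong (pow w) (ℤ.neg-distribʳ-* a (+ suc n)) ⟨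
    pow w (- (a ℤ.* + suc n))     ≈⟨ pow-neg w (a ℤ.* + suc n) ⟩
    inv (pow w (a ℤ.* + suc n))   ≈⟨ ⁻¹-cong (pow-*ℕ w a (suc n)) ⟩
    inv (powℕ (pow w a) (suc n))  ≈⟨ powℕ-inv (pow w a) (suc n) ⟩
    pow (pow w a) -[1+ n ] ∎

  pow-cong : ∀ {v w} a → v ≈ w → pow v a ≈ pow w a
  pow-cong (+ n)    v≈w = powℕ-cong n v≈w
  pow-cong -[1+ n ] v≈w = powℕ-cong (suc n) (⁻¹-cong v≈w)

  pow-ε : ∀ a → pow e a ≈ e
  pow-ε (+ n)    = powℕ-ε n
  pow-ε -[1+ n ] = trans (powℕ-cong (suc n) ε⁻¹≈ε) (powℕ-ε (suc n))

  pow-inverseʳ : ∀ w a → pow w a · pow w (- a) ≈ e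
  pow-inverseʳ w a = trans (sym (pow-+ w a (- a))) (reflexive (≡.cong (pow w) (ℤ.+-inverseʳ a)))

  pow-inverseˡ : ∀ w a → pow w (- a) · pow w a ≈ e
  pow-inverseˡ w a = trans (sym (pow-+ w (- a) a)) (reflexive (≡.cong (pow w) (ℤ.+-inverseˡ a)))

  pow-conj : ∀ c w a → c · pow w a · inv c ≈ pow (c · w · inv c) a
  pow-conj c w (+ n)    = powℕ-conj c w n
  pow-conj c w -[1+ n ] = trans (powℕ-conj c (inv w) (suc n)) (powℕ-cong (suc n) (conj-inv c w))

  pow-commutes : ∀ w a → w · pow w a ≈ pow w a · w
  pow-commutes w a = begin
    w · pow w a        ≈⟨ pow-suc w a ⟨
    pow w (+ 1 + a)    ≡⟨ ≡.cong (pow w) (ℤ.+-comm (+ 1) a) ⟩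
    pow w (a + + 1)    ≈⟨ pow-+ w a (+ 1) ⟩
    pow w a · (w · e)  ≈⟨ ∙-congˡ (identityʳ w) ⟩
    pow w a · w ∎

  inv≈powℕ : ∀ {w} m → powℕ w (suc m) ≈ e → inv w ≈ powℕ w m
  inv≈powℕ {w} m wᵐ⁺¹≈e = sym (inverseʳ-unique w (powℕ w m) wᵐ⁺¹≈e)

  pow≈powℕ : ∀ {w} m → powℕ w (suc m) ≈ e → ∀ a → ∃ λ n → pow w a ≈ powℕ w n
  pow≈powℕ m wᵐ⁺¹≈e (+ n)         = n , refl
  pow≈powℕ {w} m wᵐ⁺¹≈e -[1+ n ]  = suc n ℕ.* m , (begin
    powℕ (inv w) (suc n)     ≈⟨ powℕ-cong (suc n) (inv≈powℕ m wᵐ⁺¹≈e) ⟩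
    powℕ (powℕ w m) (suc n)  ≈⟨ powℕ-* w (suc n) m ⟨
    powℕ w (suc n ℕ.* m) ∎)

  -- For Γ-wordGroup, _∈⟨_⟩, SameSubgroup, NormalCyclic and Tight unfold to their namesakes in Defs.
  infix 4 _∈⟨_⟩
  _∈⟨_⟩ : Word → Word → Set ℓ
  x ∈⟨ g ⟩ = ∃ λ (k : ℤ) → x ≈ pow g k

  ∈⟨⟩-resp : ∀ {x x′ g g′} → x ≈ x′ → g ≈ g′ → x ∈⟨ g ⟩ → x′ ∈⟨ g′ ⟩
  ∈⟨⟩-resp x≈x′ g≈g′ (k , x≈gᵏ) = k , trans (sym x≈x′) (trans x≈gᵏ (pow-cong k g≈g′))

  ∈⟨⟩-gen : ∀ g → g ∈⟨ g ⟩
  ∈⟨⟩-gen g = + 1 , sym (identityʳ g)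

  ∈⟨⟩-inv : ∀ g → inv g ∈⟨ g ⟩
  ∈⟨⟩-inv g = -[1+ 0 ] , sym (identityʳ (inv g))

  ∈⟨⟩-trans : ∀ {x g h} → x ∈⟨ g ⟩ → g ∈⟨ h ⟩ → x ∈⟨ h ⟩
  ∈⟨⟩-trans {h = h} (k , x≈gᵏ) (l , g≈hˡ) = l ℤ.* k , trans x≈gᵏ (trans (pow-cong k g≈hˡ) (sym (pow-* h l k)))

  ∈⟨ε⟩ : ∀ {x g} → x ∈⟨ g ⟩ → g ≈ e → x ≈ e
  ∈⟨ε⟩ (k , x≈gᵏ) g≈e = trans x≈gᵏ (trans (pow-cong k g≈e) (pow-ε k))

  SameSubgroup : Word → Word → Set ℓ
  SameSubgroup g h = ∀ x → (x ∈⟨ g ⟩) ⇔ (x ∈⟨ h ⟩)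

  mutual∈⇒SameSubgroup : ∀ {g h} → g ∈⟨ h ⟩ → h ∈⟨ g ⟩ → SameSubgroup g h
  mutual∈⇒SameSubgroup g∈⟨h⟩ h∈⟨g⟩ x =
    mk⇔ (λ x∈⟨g⟩ → ∈⟨⟩-trans x∈⟨g⟩ g∈⟨h⟩) (λ x∈⟨h⟩ → ∈⟨⟩-trans x∈⟨h⟩ h∈⟨g⟩)

  SameSubgroup-sym : ∀ {g h} → SameSubgroup g h → SameSubgroup h g
  SameSubgroup-sym g~h x = ⇔-sym (g~h x)

  SameSubgroup-trans : ∀ {g h k} → SameSubgroup g h → SameSubgroup h k → SameSubgroup g k
  SameSubgroup-trans g~h h~k x = h~k x ⇔-∘ g~h x

  SameSubgroup-neg : ∀ w a → SameSubgroup (pow w (- a)) (pow w a)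
  SameSubgroup-neg w a = mutual∈⇒SameSubgroup
    (∈⟨⟩-resp (sym (pow-neg w a)) refl (∈⟨⟩-inv (pow w a)))
    (∈⟨⟩-resp (trans (sym (pow-neg w (- a))) (reflexive (≡.cong (pow w) (ℤ.neg-involutive a)))) refl
              (∈⟨⟩-inv (pow w (- a))))

  -- ord h ∣ ord g, phrased without orders
  OrderDivides : Word → Word → Set ℓ
  OrderDivides h g = ∀ k → powℕ g k ≈ e → powℕ h k ≈ e

  OrderDivides-resp : ∀ {h h′ g g′} → h ≈ h′ → g ≈ g′ → OrderDivides h g → OrderDivides h′ g′
  OrderDivides-resp h≈h′ g≈g′ h∣g k g′ᵏ≈e =
    trans (powℕ-cong k (sym h≈h′)) (h∣g k (trans (powℕ-cong k g≈g′) g′ᵏ≈e))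

  conj⇒OrderDivides : ∀ {c g h} → c · g · inv c ≈ h → OrderDivides h g
  conj⇒OrderDivides {c} {g} {h} cgc⁻¹≈h k gᵏ≈e = begin
    powℕ h k                ≈⟨ powℕ-cong k cgc⁻¹≈h ⟨
    powℕ (c · g · inv c) k  ≈⟨ powℕ-conj c g k ⟨
    c · powℕ g k · inv c    ≈⟨ conj-cong c gᵏ≈e ⟩
    c · e · inv c           ≈⟨ conj-ε c ⟩
    e ∎

  powℕ-multiple : ∀ {b} m k → powℕ b m ≈ e → powℕ b (k ℕ.* m) ≈ e
  powℕ-multiple {b} m k bᵐ≈e = trans (powℕ-* b k m) (trans (powℕ-cong k bᵐ≈e) (powℕ-ε k))

  powℕ-gcd∈⟨⟩ : ∀ {b} d m → powℕ b m ≈ e → powℕ b (gcd d m) ∈⟨ powℕ b d ⟩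
  powℕ-gcd∈⟨⟩ {b} d m bᵐ≈e with Bézout.identity (gcd-GCD d m)
  ... | Bézout.+- x y g+ym≡xd = + x , (begin
    powℕ b (gcd d m)                     ≈⟨ identityʳ _ ⟨
    powℕ b (gcd d m) · e                 ≈⟨ ∙-congˡ (powℕ-multiple m y bᵐ≈e) ⟨
    powℕ b (gcd d m) · powℕ b (y ℕ.* m)  ≈⟨ powℕ-+ b (gcd d m) (y ℕ.* m) ⟨
    powℕ b (gcd d m ℕ.+ y ℕ.* m)         ≡⟨ ≡.cong (powℕ b) g+ym≡xd ⟩
    powℕ b (x ℕ.* d)                     ≈⟨ powℕ-* b x d ⟩
    powℕ (powℕ b d) x ∎)
  ... | Bézout.-+ x y g+xd≡ym = - + x , (begin
    powℕ b (gcd d m)  ≈⟨ inverseˡ-unique _ _ (begin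
      powℕ b (gcd d m) · powℕ b (x ℕ.* d)        ≈⟨ powℕ-+ b (gcd d m) (x ℕ.* d) ⟨
      powℕ b (gcd d m ℕ.+ x ℕ.* d)               ≡⟨ ≡.cong (powℕ b) g+xd≡ym ⟩
      powℕ b (y ℕ.* m)                           ≈⟨ powℕ-multiple m y bᵐ≈e ⟩
      e                                          ∎) ⟩
    inv (powℕ b (x ℕ.* d))      ≈⟨ ⁻¹-cong (powℕ-* b x d) ⟩
    inv (pow (powℕ b d) (+ x))  ≈⟨ pow-neg (powℕ b d) (+ x) ⟨
    pow (powℕ b d) (- + x) ∎)

  gcd∣⇒∈⟨⟩ : ∀ {b} d f m → powℕ b m ≈ e → gcd d m ∣ f → powℕ b f ∈⟨ powℕ b d ⟩
  gcd∣⇒∈⟨⟩ {b} d f m bᵐ≈e (divides k f≡kg) = ∈⟨⟩-trans bᶠ∈⟨bᵍ⟩ (powℕ-gcd∈⟨⟩ d m bᵐ≈e)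
    where
    bᶠ∈⟨bᵍ⟩ : powℕ b f ∈⟨ powℕ b (gcd d m) ⟩
    bᶠ∈⟨bᵍ⟩ = + k , trans (reflexive (≡.cong (powℕ b) f≡kg)) (powℕ-* b k (gcd d m))

  -- Writing g = gcd d m and m = m′ g: the order of b^d divides m′, hence so does that of b^f,
  -- so b has exponent gcd m (m′ f); either that is m, and then g ∣ f, or it is a smaller exponent.
  orderDivides⇒∈⟨⟩ : ∀ {b} d f m .{{_ : NonZero m}} → powℕ b m ≈ e →
                     OrderDivides (powℕ b f) (powℕ b d) → powℕ b f ∈⟨ powℕ b d ⟩
  orderDivides⇒∈⟨⟩ {b} d f m bᵐ≈e bᶠ∣bᵈ = descend m (<-wellFounded m) bᵐ≈e
    where
    descend : ∀ m → Acc _<_ m → .{{NonZero m}} → powℕ b m ≈ e → powℕ b f ∈⟨ powℕ b d ⟩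
    descend m (acc smaller) bᵐ≈e with gcd[m,n]∣m d m | gcd[m,n]∣n d m
    ... | divides dg d≡dg*g | divides zero m≡0 = contradiction m≡0 (≢-nonZero⁻¹ m)
    ... | divides dg d≡dg*g | divides m′@(suc _) m≡m′*g with m ∣? m′ ℕ.* f
    ...   | yes m∣m′f = gcd∣⇒∈⟨⟩ d f m bᵐ≈e (*-cancelˡ-∣ m′ (≡.subst (_∣ m′ ℕ.* f) m≡m′*g m∣m′f))
    ...   | no  m∤m′f = descend (gcd m (m′ ℕ.* f)) (smaller m″<m) {{m″≢0}} bᵐ″≈e
      where
      m′d≡dg*m : m′ ℕ.* d ≡ dg ℕ.* m
      m′d≡dg*m = ≡.trans (≡.cong (m′ ℕ.*_) d≡dg*g)
        (≡.trans (ℕ-CommSemigroup.x∙yz≈y∙xz m′ dg (gcd d m)) (≡.cong (dg ℕ.*_) (≡.sym m≡m′*g)))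
      bᵐ′ᶠ≈e : powℕ b (m′ ℕ.* f) ≈ e
      bᵐ′ᶠ≈e = trans (powℕ-* b m′ f) (bᶠ∣bᵈ m′ (trans (sym (powℕ-* b m′ d))
                 (trans (reflexive (≡.cong (powℕ b) m′d≡dg*m)) (powℕ-multiple m dg bᵐ≈e))))
      bᵐ″≈e : powℕ b (gcd m (m′ ℕ.* f)) ≈ e
      bᵐ″≈e = ∈⟨ε⟩ (powℕ-gcd∈⟨⟩ m (m′ ℕ.* f) bᵐ′ᶠ≈e) bᵐ≈e
      m″<m : gcd m (m′ ℕ.* f) < m
      m″<m = ℕ.≤∧≢⇒< (∣⇒≤ (gcd[m,n]∣m m (m′ ℕ.* f)))
               (λ m″≡m → m∤m′f (≡.subst (_∣ m′ ℕ.* f) m″≡m (gcd[m,n]∣n m (m′ ℕ.* f))))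
      m″≢0 : NonZero (gcd m (m′ ℕ.* f))
      m″≢0 = ℕ.≢-nonZero (gcd[m,n]≢0 m (m′ ℕ.* f) (inj₁ (≢-nonZero⁻¹ m)))

  conjugate⇒∈⟨⟩ : ∀ {X c} m a b → powℕ X (suc m) ≈ e → c · pow X a · inv c ≈ pow X b → pow X b ∈⟨ pow X a ⟩
  conjugate⇒∈⟨⟩ m a b Xᵐ⁺¹≈e conj with pow≈powℕ m Xᵐ⁺¹≈e a | pow≈powℕ m Xᵐ⁺¹≈e b
  ... | d , Xᵃ≈Xᵈ | f , Xᵇ≈Xᶠ = ∈⟨⟩-resp (sym Xᵇ≈Xᶠ) (sym Xᵃ≈Xᵈ)
    (orderDivides⇒∈⟨⟩ d f (suc m) Xᵐ⁺¹≈e (OrderDivides-resp Xᵇ≈Xᶠ Xᵃ≈Xᵈ (conj⇒OrderDivides conj)))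

  conjugate⇒SameSubgroup : ∀ {X c} m a b → powℕ X (suc m) ≈ e → c · pow X a · inv c ≈ pow X b →
                           SameSubgroup (pow X a) (pow X b)
  conjugate⇒SameSubgroup m a b Xᵐ⁺¹≈e conj = mutual∈⇒SameSubgroup
    (conjugate⇒∈⟨⟩ m b a Xᵐ⁺¹≈e (conj-flip conj)) (conjugate⇒∈⟨⟩ m a b Xᵐ⁺¹≈e conj)

  NormalizedBy : Word → Word → Set ℓ
  NormalizedBy g c = ∀ x → x ∈⟨ g ⟩ → c · x · inv c ∈⟨ g ⟩

  NormalCyclic : Word → Set ℓ
  NormalCyclic g = ∀ c → NormalizedBy g c

  conj∈⇒NormalizedBy : ∀ {g c} → c · g · inv c ∈⟨ g ⟩ → NormalizedBy g c
  conj∈⇒NormalizedBy {g} {c} cgc⁻¹∈⟨g⟩ x (k , x≈gᵏ) =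
    ∈⟨⟩-trans (k , trans (conj-cong c x≈gᵏ) (pow-conj c g k)) cgc⁻¹∈⟨g⟩

  NormalizedBy-resp-Same : ∀ {g h c} → SameSubgroup g h → NormalizedBy g c → NormalizedBy h c
  NormalizedBy-resp-Same g~h c-normalizes x x∈⟨h⟩ =
    Equivalence.to (g~h _) (c-normalizes x (Equivalence.from (g~h x) x∈⟨h⟩))

  NormalCyclic-resp-Same : ∀ {g h} → SameSubgroup g h → NormalCyclic g → NormalCyclic h
  NormalCyclic-resp-Same g~h g-normal c = NormalizedBy-resp-Same g~h (g-normal c)

  pow-NormalizedBy : ∀ w a → NormalizedBy (pow w a) w
  pow-NormalizedBy w a = conj∈⇒NormalizedBy
    (∈⟨⟩-resp (sym (trans (∙-congʳ (pow-commutes w a)) (//-rightDividesʳ w (pow w a)))) refl (∈⟨⟩-gen (pow w a)))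

  conjugate⇒NormalizedBy : ∀ {c u v} → c · u · inv c ≈ v → SameSubgroup u v → NormalizedBy u c
  conjugate⇒NormalizedBy {v = v} cuc⁻¹≈v u~v =
    conj∈⇒NormalizedBy (∈⟨⟩-resp (sym cuc⁻¹≈v) refl (Equivalence.from (u~v v) (∈⟨⟩-gen v)))

  record IsSubmonoid {p} (P : Word → Set p) : Set (ℓ ⊔ p) where
    field
      resp : ∀ {x y} → x ≈ y → P x → P y
      ε∈   : P e
      ·∈   : ∀ {x y} → P x → P y → P (x · y)

    powℕ∈ : ∀ {x} n → P x → P (powℕ x n)
    powℕ∈ zero    Px = ε∈
    powℕ∈ (suc n) Px = ·∈ Px (powℕ∈ n Px)

    inv∈ : ∀ {x} m → powℕ x (suc m) ≈ e → P x → P (inv x)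
    inv∈ m xᵐ⁺¹≈e Px = resp (sym (inv≈powℕ m xᵐ⁺¹≈e)) (powℕ∈ m Px)

    -- σ₁ and σ₂ generate the group, and being of finite order they generate it as a monoid
    σ₁σ₂∈⇒universal : ∀ m n → powℕ s1 (suc m) ≈ e → powℕ s2 (suc n) ≈ e → P s1 → P s2 → ∀ w → P w
    σ₁σ₂∈⇒universal m n σ₁ᵐ⁺¹≈e σ₂ⁿ⁺¹≈e Pσ₁ Pσ₂ w = proj₁ (closed w)
      where
      closed : ∀ w → P w × P (inv w)
      closed (gen σ₁) = Pσ₁ , inv∈ m σ₁ᵐ⁺¹≈e Pσ₁
      closed (gen σ₂) = Pσ₂ , inv∈ n σ₂ⁿ⁺¹≈e Pσ₂
      closed e        = ε∈ , resp (sym ε⁻¹≈ε) ε∈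
      closed (v · w)  = ·∈ (proj₁ (closed v)) (proj₁ (closed w))
                      , resp (sym (⁻¹-anti-homo-∙ v w)) (·∈ (proj₂ (closed w)) (proj₂ (closed v)))
      closed (inv w)  = proj₂ (closed w) , resp (sym (⁻¹-involutive w)) (proj₁ (closed w))

  NormalizedBy-isSubmonoid : ∀ g → IsSubmonoid (NormalizedBy g)
  NormalizedBy-isSubmonoid g = record
    { resp = λ {c} {c′} c≈c′ c-normalizes x x∈⟨g⟩ →
        ∈⟨⟩-resp (∙-cong (∙-congʳ c≈c′) (⁻¹-cong c≈c′)) refl (c-normalizes x x∈⟨g⟩)
    ; ε∈   = λ x x∈⟨g⟩ → ∈⟨⟩-resp (sym (trans (∙-cong (identityˡ x) ε⁻¹≈ε) (identityʳ x))) refl x∈⟨g⟩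
    ; ·∈   = λ {c} {d} c-normalizes d-normalizes x x∈⟨g⟩ →
        ∈⟨⟩-resp (sym (conj-∘ c d x)) refl (c-normalizes _ (d-normalizes x x∈⟨g⟩))
    }

  normalCyclic-byGenerators : ∀ {g} m n → powℕ s1 (suc m) ≈ e → powℕ s2 (suc n) ≈ e →
                              NormalizedBy g s1 → NormalizedBy g s2 → NormalCyclic g
  normalCyclic-byGenerators {g} = IsSubmonoid.σ₁σ₂∈⇒universal (NormalizedBy-isSubmonoid g)

  infix 4 _∈⟨σ₁⟩⟨σ₂⟩
  _∈⟨σ₁⟩⟨σ₂⟩ : Word → Set ℓ
  w ∈⟨σ₁⟩⟨σ₂⟩ = ∃ λ (a : ℤ) → ∃ λ (b : ℤ) → w ≈ pow s1 a · pow s2 b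

  Tight : Set ℓ
  Tight = ∀ w → w ∈⟨σ₁⟩⟨σ₂⟩

  ∈⟨σ₁⟩⟨σ₂⟩-resp : ∀ {x y} → x ≈ y → x ∈⟨σ₁⟩⟨σ₂⟩ → y ∈⟨σ₁⟩⟨σ₂⟩
  ∈⟨σ₁⟩⟨σ₂⟩-resp x≈y (a , b , x≈σ₁ᵃσ₂ᵇ) = a , b , trans (sym x≈y) x≈σ₁ᵃσ₂ᵇ

  ∈⟨σ₁⟩⟨σ₂⟩-·σ₂ᵇ : ∀ {x} b → x ∈⟨σ₁⟩⟨σ₂⟩ → x · pow s2 b ∈⟨σ₁⟩⟨σ₂⟩
  ∈⟨σ₁⟩⟨σ₂⟩-·σ₂ᵇ {x} b (a′ , b′ , x≈σ₁ᵃ′σ₂ᵇ′) = a′ , b′ + b , (begin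
    x · pow s2 b                        ≈⟨ ∙-congʳ x≈σ₁ᵃ′σ₂ᵇ′ ⟩
    pow s1 a′ · pow s2 b′ · pow s2 b    ≈⟨ assoc _ _ _ ⟩
    pow s1 a′ · (pow s2 b′ · pow s2 b)  ≈⟨ ∙-congˡ (pow-+ s2 b′ b) ⟨
    pow s1 a′ · pow s2 (b′ + b) ∎)

  Preserves⟨σ₁⟩⟨σ₂⟩ : Word → Set ℓ
  Preserves⟨σ₁⟩⟨σ₂⟩ w = ∀ x → x ∈⟨σ₁⟩⟨σ₂⟩ → w · x ∈⟨σ₁⟩⟨σ₂⟩

  Preserves⟨σ₁⟩⟨σ₂⟩-isSubmonoid : IsSubmonoid Preserves⟨σ₁⟩⟨σ₂⟩
  Preserves⟨σ₁⟩⟨σ₂⟩-isSubmonoid = record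
    { resp = λ w≈w′ w· x x∈ → ∈⟨σ₁⟩⟨σ₂⟩-resp (∙-congʳ w≈w′) (w· x x∈)
    ; ε∈   = λ x x∈ → ∈⟨σ₁⟩⟨σ₂⟩-resp (sym (identityˡ x)) x∈
    ; ·∈   = λ v· w· x x∈ → ∈⟨σ₁⟩⟨σ₂⟩-resp (sym (assoc _ _ x)) (v· _ (w· x x∈))
    }

  tight-criterion : ∀ m n → powℕ s1 (suc m) ≈ e → powℕ s2 (suc n) ≈ e →
                    (∀ k → s2 · powℕ s1 k ∈⟨σ₁⟩⟨σ₂⟩) → Tight
  tight-criterion m n σ₁ᵐ⁺¹≈e σ₂ⁿ⁺¹≈e σ₂σ₁ᵏ∈ w = ∈⟨σ₁⟩⟨σ₂⟩-resp (identityʳ w)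
    (IsSubmonoid.σ₁σ₂∈⇒universal Preserves⟨σ₁⟩⟨σ₂⟩-isSubmonoid m n σ₁ᵐ⁺¹≈e σ₂ⁿ⁺¹≈e
      σ₁-preserves σ₂-preserves
      w e (+ 0 , + 0 , sym (identityˡ e)))
    where
    σ₁-preserves : Preserves⟨σ₁⟩⟨σ₂⟩ s1
    σ₁-preserves x (a , b , x≈σ₁ᵃσ₂ᵇ) = + 1 + a , b ,
      trans (∙-congˡ x≈σ₁ᵃσ₂ᵇ) (trans (sym (assoc s1 _ _)) (∙-congʳ (sym (pow-suc s1 a))))
    σ₂-preserves : Preserves⟨σ₁⟩⟨σ₂⟩ s2
    σ₂-preserves x (a , b , x≈σ₁ᵃσ₂ᵇ) with pow≈powℕ m σ₁ᵐ⁺¹≈e a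
    ... | k , σ₁ᵃ≈σ₁ᵏ = ∈⟨σ₁⟩⟨σ₂⟩-resp (trans (assoc _ _ _) (∙-congˡ (sym x≈σ₁ᵃσ₂ᵇ)))
          (∈⟨σ₁⟩⟨σ₂⟩-·σ₂ᵇ b (∈⟨σ₁⟩⟨σ₂⟩-resp (∙-congˡ (sym σ₁ᵃ≈σ₁ᵏ)) (σ₂σ₁ᵏ∈ k)))

  infix 4 _∈_·⟨_⟩
  _∈_·⟨_⟩ : Word → Word → Word → Set ℓ
  x ∈ c ·⟨ g ⟩ = ∃ λ (k : ℤ) → x ≈ c · pow g k

  coset-resp : ∀ {x x′ c c′ g} → x ≈ x′ → c ≈ c′ → x ∈ c ·⟨ g ⟩ → x′ ∈ c′ ·⟨ g ⟩
  coset-resp x≈x′ c≈c′ (k , x≈cgᵏ) = k , trans (sym x≈x′) (trans x≈cgᵏ (∙-congʳ c≈c′))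

  coset-·ʳ : ∀ {x c g} y → NormalCyclic g → x ∈ c ·⟨ g ⟩ → x · y ∈ (c · y) ·⟨ g ⟩
  coset-·ʳ {x} {c} {g} y g-normal (k , x≈cgᵏ) with g-normal (inv y) (pow g k) (k , refl)
  ... | l , y⁻¹gᵏy≈gˡ = l , (begin
    x · y                                      ≈⟨ ∙-congʳ x≈cgᵏ ⟩
    c · pow g k · y                            ≈⟨ ∙-congʳ (∙-congʳ (identityʳ c)) ⟨
    c · e · pow g k · y                        ≈⟨ ∙-congʳ (∙-congʳ (∙-congˡ (inverseʳ y))) ⟨
    c · (y · inv y) · pow g k · y              ≈⟨ solve 4 (λ c y y′ gᵏ → ((c ⊕ (y ⊕ y′)) ⊕ gᵏ) ⊕ y ⊜ (c ⊕ y) ⊕ ((y′ ⊕ gᵏ) ⊕ y))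
                                                    refl c y (inv y) (pow g k) ⟩
    (c · y) · (inv y · pow g k · y)            ≈⟨ ∙-congˡ (∙-congˡ (⁻¹-involutive y)) ⟨
    (c · y) · (inv y · pow g k · inv (inv y))  ≈⟨ ∙-congˡ y⁻¹gᵏy≈gˡ ⟩
    (c · y) · pow g l ∎)

  coset-absorb : ∀ {x c g} → x ∈ (c · g) ·⟨ g ⟩ → x ∈ c ·⟨ g ⟩
  coset-absorb {c = c} {g} (k , x≈cggᵏ) = + 1 + k , trans x≈cggᵏ (trans (assoc c g _) (∙-congˡ (sym (pow-suc g k))))

  coset⇒∈⟨σ₁⟩⟨σ₂⟩ : ∀ {x} a b d → x ∈ (pow s1 a · pow s2 b) ·⟨ pow s2 d ⟩ → x ∈⟨σ₁⟩⟨σ₂⟩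
  coset⇒∈⟨σ₁⟩⟨σ₂⟩ {x} a b d (k , x≈σ₁ᵃσ₂ᵇσ₂ᵈᵏ) = a , b + d ℤ.* k , (begin
    x                                         ≈⟨ x≈σ₁ᵃσ₂ᵇσ₂ᵈᵏ ⟩
    pow s1 a · pow s2 b · pow (pow s2 d) k    ≈⟨ ∙-congˡ (pow-* s2 d k) ⟨
    pow s1 a · pow s2 b · pow s2 (d ℤ.* k)    ≈⟨ assoc _ _ _ ⟩
    pow s1 a · (pow s2 b · pow s2 (d ℤ.* k))  ≈⟨ ∙-congˡ (pow-+ s2 b (d ℤ.* k)) ⟨
    pow s1 a · pow s2 (b + d ℤ.* k) ∎)

private
  i+-[i-1]≡1 : ∀ i → i + - (i - + 1) ≡ + 1
  i+-[i-1]≡1 = solve-∀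

  i≡1+[i-1] : ∀ i → i ≡ + 1 + (i - + 1)
  i≡1+[i-1] = solve-∀

  -[i-1]≡1-i : ∀ i → - (i - + 1) ≡ + 1 + - i
  -[i-1]≡1-i = solve-∀

Γ-wordGroup : (p q : ℕ) (i₁ j₁ i₂ j₂ : ℤ) → WordGroup 0ℓ
Γ-wordGroup p q i₁ j₁ i₂ j₂ = record
  { _≈_     = _≈_
  ; isGroup = record
    { isMonoid = record
      { isSemigroup = record
        { isMagma = record
          { isEquivalence = record { refl = ≈-refl ; sym = ≈-sym ; trans = ≈-trans }
          ; ∙-cong = ·-cong }
        ; assoc = assoc }
      ; identity = idˡ , idʳ }
    ; inverse = invˡ , invʳ
    ; ⁻¹-cong = inv-cong }
  }
  where open Γ p q i₁ j₁ i₂ j₂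

module Γ-Properties (p q : ℕ) (i₁ j₁ i₂ j₂ : ℤ) where
  open Γ p q i₁ j₁ i₂ j₂ public using (_≈_; rel-p; rel-q; rel-2; rel-1; rel-2′)
  open WordGroup (Γ-wordGroup p q i₁ j₁ i₂ j₂) public using (isGroup; group)
  open WordGroupProperties (Γ-wordGroup p q i₁ j₁ i₂ j₂) public
  open GroupProperties group public using (\\-leftDividesˡ; //-rightDividesˡ; ⁻¹-involutive)
  open IsGroup isGroup public
    using (refl; reflexive; sym; trans; setoid; assoc; identityˡ; identityʳ; inverseˡ; inverseʳ; ∙-cong; ∙-congˡ; ∙-congʳ)
  open import Algebra.Solver.Monoid (Group.monoid group) public using (solve; _⊜_; _⊕_; id)
  open import Relation.Binary.Reasoning.Setoid setoid public

  σ₂σ₁≈σ₁⁻¹σ₂⁻¹ : s2 · s1 ≈ inv s1 · inv s2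
  σ₂σ₁≈σ₁⁻¹σ₂⁻¹ = sym (begin
    inv s1 · inv s2                                  ≈⟨ ∙-congʳ (identityʳ (inv s1)) ⟨
    inv s1 · e · inv s2                              ≈⟨ ∙-congʳ (∙-congˡ rel-2) ⟨
    inv s1 · ((s1 · s2) · ((s1 · s2) · e)) · inv s2  ≈⟨ solve 4 (λ a b a′ b′ → (a′ ⊕ ((a ⊕ b) ⊕ ((a ⊕ b) ⊕ id))) ⊕ b′ ⊜ ((a′ ⊕ a) ⊕ (b ⊕ a)) ⊕ (b ⊕ b′))
                                                          refl s1 s2 (inv s1) (inv s2) ⟩
    (inv s1 · s1) · (s2 · s1) · (s2 · inv s2)        ≈⟨ ∙-cong (∙-congʳ (inverseˡ s1)) (inverseʳ s2) ⟩
    e · (s2 · s1) · e                                ≈⟨ trans (identityʳ _) (identityˡ _) ⟩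
    s2 · s1 ∎)

module Γ[i,j₁,-i,j₂] (m n : ℕ) (i j₁ j₂ : ℤ) where
  open Γ-Properties (suc m) (suc n) i j₁ (- i) j₂

  σ₁-conj : s1 · pow s2 (- (j₁ - + 1)) · inv s1 ≈ pow s2 (j₂ + + 1)
  σ₁-conj = begin
    s1 · pow s2 (- (j₁ - + 1)) · inv s1                           ≈⟨ ∙-congʳ (∙-congʳ σ₁≈σ₂σ₁ⁱσ₂ʲ¹) ⟩
    s2 · (pow s1 i · pow s2 j₁) · pow s2 (- (j₁ - + 1)) · inv s1  ≈⟨ solve 5 (λ a b c d e → ((a ⊕ (b ⊕ c)) ⊕ d) ⊕ e ⊜ (a ⊕ b) ⊕ ((c ⊕ d) ⊕ e))
                                                                       refl s2 (pow s1 i) (pow s2 j₁) (pow s2 (- (j₁ - + 1))) (inv s1) ⟩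
    s2 · pow s1 i · (pow s2 j₁ · pow s2 (- (j₁ - + 1)) · inv s1)  ≈⟨ ∙-congˡ (∙-congʳ σ₂ʲ¹σ₂¹⁻ʲ¹≈σ₂) ⟩
    s2 · pow s1 i · (s2 · inv s1)                                 ≈⟨ ∙-congˡ rel-2′ ⟩
    s2 · pow s1 i · (pow s1 (- i) · pow s2 j₂)                    ≈⟨ solve 4 (λ a b c d → (a ⊕ b) ⊕ (c ⊕ d) ⊜ (a ⊕ (b ⊕ c)) ⊕ d)
                                                                       refl s2 (pow s1 i) (pow s1 (- i)) (pow s2 j₂) ⟩
    s2 · (pow s1 i · pow s1 (- i)) · pow s2 j₂                    ≈⟨ ∙-congʳ (trans (∙-congˡ (pow-inverseʳ s1 i)) (identityʳ s2)) ⟩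
    s2 · pow s2 j₂                                                ≈⟨ pow-suc s2 j₂ ⟨
    pow s2 (+ 1 + j₂)                                             ≡⟨ ≡.cong (pow s2) (ℤ.+-comm (+ 1) j₂) ⟩
    pow s2 (j₂ + + 1) ∎
    where
    σ₁≈σ₂σ₁ⁱσ₂ʲ¹ : s1 ≈ s2 · (pow s1 i · pow s2 j₁)
    σ₁≈σ₂σ₁ⁱσ₂ʲ¹ = trans (sym (\\-leftDividesˡ s2 s1)) (∙-congˡ rel-1)
    σ₂ʲ¹σ₂¹⁻ʲ¹≈σ₂ : pow s2 j₁ · pow s2 (- (j₁ - + 1)) ≈ s2
    σ₂ʲ¹σ₂¹⁻ʲ¹≈σ₂ = trans (sym (pow-+ s2 j₁ _)) (trans (reflexive (≡.cong (pow s2) (i+-[i-1]≡1 j₁))) (identityʳ s2))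

  conj-same : SameSubgroup (pow s2 (- (j₁ - + 1))) (pow s2 (j₂ + + 1))
  conj-same = conjugate⇒SameSubgroup n (- (j₁ - + 1)) (j₂ + + 1) rel-q σ₁-conj

  sameSubgroup : SameSubgroup (pow s2 (j₁ - + 1)) (pow s2 (j₂ + + 1))
  sameSubgroup = SameSubgroup-trans (SameSubgroup-sym (SameSubgroup-neg s2 (j₁ - + 1))) conj-same

  normal-j₁-1 : NormalCyclic (pow s2 (j₁ - + 1))
  normal-j₁-1 = NormalCyclic-resp-Same (SameSubgroup-neg s2 (j₁ - + 1))
    (normalCyclic-byGenerators m n rel-p rel-q (conjugate⇒NormalizedBy σ₁-conj conj-same)
      (pow-NormalizedBy s2 (- (j₁ - + 1))))

  normal-j₂+1 : NormalCyclic (pow s2 (j₂ + + 1))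
  normal-j₂+1 = NormalCyclic-resp-Same sameSubgroup normal-j₁-1

  σ₂⁻¹σ₁≈σ₁ⁱσ₂σ₂ʲ¹⁻¹ : inv s2 · s1 ≈ pow s1 i · s2 · pow s2 (j₁ - + 1)
  σ₂⁻¹σ₁≈σ₁ⁱσ₂σ₂ʲ¹⁻¹ = begin
    inv s2 · s1                           ≈⟨ rel-1 ⟩
    pow s1 i · pow s2 j₁                  ≡⟨ ≡.cong (λ b → pow s1 i · pow s2 b) (i≡1+[i-1] j₁) ⟩
    pow s1 i · pow s2 (+ 1 + (j₁ - + 1))  ≈⟨ ∙-congˡ (pow-suc s2 (j₁ - + 1)) ⟩
    pow s1 i · (s2 · pow s2 (j₁ - + 1))   ≈⟨ assoc _ _ _ ⟨
    pow s1 i · s2 · pow s2 (j₁ - + 1) ∎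

  σ₂σ₁ᵏ∈coset : ∀ k → ∃ λ a → s2 · powℕ s1 k ∈ (pow s1 a · s2) ·⟨ pow s2 (j₁ - + 1) ⟩
                              ⊎ s2 · powℕ s1 k ∈ (pow s1 a · inv s2) ·⟨ pow s2 (j₁ - + 1) ⟩
  σ₂σ₁ᵏ∈coset zero = + 0 , inj₁ (+ 0 , ∙-congʳ (sym (identityˡ s2)))
  σ₂σ₁ᵏ∈coset (suc k) with σ₂σ₁ᵏ∈coset k
  ... | a , inj₁ ∈σ₁ᵃσ₂N = a + -[1+ 0 ] , inj₂ (coset-resp (·powℕ-sucʳ s2 s1 k) (begin
    pow s1 a · s2 · s1                   ≈⟨ assoc _ _ _ ⟩
    pow s1 a · (s2 · s1)                 ≈⟨ ∙-congˡ σ₂σ₁≈σ₁⁻¹σ₂⁻¹ ⟩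
    pow s1 a · (inv s1 · inv s2)         ≈⟨ assoc _ _ _ ⟨
    pow s1 a · inv s1 · inv s2           ≈⟨ ∙-congʳ (∙-congˡ (identityʳ (inv s1))) ⟨
    pow s1 a · pow s1 -[1+ 0 ] · inv s2  ≈⟨ ∙-congʳ (pow-+ s1 a -[1+ 0 ]) ⟨
    pow s1 (a + -[1+ 0 ]) · inv s2     ∎) (coset-·ʳ s1 normal-j₁-1 ∈σ₁ᵃσ₂N))
  ... | a , inj₂ ∈σ₁ᵃσ₂⁻¹N = a + i , inj₁ (coset-absorb (coset-resp (·powℕ-sucʳ s2 s1 k) (begin
    pow s1 a · inv s2 · s1                          ≈⟨ assoc _ _ _ ⟩
    pow s1 a · (inv s2 · s1)                        ≈⟨ ∙-congˡ σ₂⁻¹σ₁≈σ₁ⁱσ₂σ₂ʲ¹⁻¹ ⟩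
    pow s1 a · (pow s1 i · s2 · pow s2 (j₁ - + 1))  ≈⟨ solve 4 (λ a b c d → a ⊕ ((b ⊕ c) ⊕ d) ⊜ ((a ⊕ b) ⊕ c) ⊕ d)
                                                         refl (pow s1 a) (pow s1 i) s2 (pow s2 (j₁ - + 1)) ⟩
    pow s1 a · pow s1 i · s2 · pow s2 (j₁ - + 1)    ≈⟨ ∙-congʳ (∙-congʳ (pow-+ s1 a i)) ⟨
    pow s1 (a + i) · s2 · pow s2 (j₁ - + 1)             ∎) (coset-·ʳ s1 normal-j₁-1 ∈σ₁ᵃσ₂⁻¹N)))

  tight : Tight
  tight = tight-criterion m n rel-p rel-q σ₂σ₁ᵏ∈⟨σ₁⟩⟨σ₂⟩
    where
    σ₂σ₁ᵏ∈⟨σ₁⟩⟨σ₂⟩ : ∀ k → s2 · powℕ s1 k ∈⟨σ₁⟩⟨σ₂⟩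
    σ₂σ₁ᵏ∈⟨σ₁⟩⟨σ₂⟩ k with σ₂σ₁ᵏ∈coset k
    ... | a , inj₁ ∈σ₁ᵃσ₂N   = coset⇒∈⟨σ₁⟩⟨σ₂⟩ a (+ 1) (j₁ - + 1)
                                  (coset-resp refl (∙-congˡ (sym (identityʳ s2))) ∈σ₁ᵃσ₂N)
    ... | a , inj₂ ∈σ₁ᵃσ₂⁻¹N = coset⇒∈⟨σ₁⟩⟨σ₂⟩ a -[1+ 0 ] (j₁ - + 1)
                                  (coset-resp refl (∙-congˡ (sym (identityʳ (inv s2)))) ∈σ₁ᵃσ₂⁻¹N)

module Γ[i₁,j,i₂,-j] (m n : ℕ) (i₁ i₂ j : ℤ) where
  open Γ-Properties (suc m) (suc n) i₁ j i₂ (- j)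

  σ₂⁻¹-conj : inv s2 · pow s1 (- (i₂ - + 1)) · inv (inv s2) ≈ pow s1 (i₁ + + 1)
  σ₂⁻¹-conj = begin
    inv s2 · pow s1 (- (i₂ - + 1)) · inv (inv s2)                      ≈⟨ ∙-cong (∙-congˡ σ₁¹⁻ⁱ²≈σ₁σ₁⁻ⁱ²) σ₂⁻¹⁻¹≈σ₁ⁱ²σ₂⁻ʲσ₁ ⟩
    inv s2 · (s1 · pow s1 (- i₂)) · (pow s1 i₂ · pow s2 (- j) · s1)    ≈⟨ solve 5 (λ a b c d e → (a ⊕ (b ⊕ c)) ⊕ ((d ⊕ e) ⊕ b) ⊜ ((a ⊕ b) ⊕ (c ⊕ d)) ⊕ (e ⊕ b))
                                                                            refl (inv s2) s1 (pow s1 (- i₂)) (pow s1 i₂) (pow s2 (- j)) ⟩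
    (inv s2 · s1) · (pow s1 (- i₂) · pow s1 i₂) · (pow s2 (- j) · s1)  ≈⟨ ∙-congʳ (trans (∙-congˡ (pow-inverseˡ s1 i₂)) (identityʳ _)) ⟩
    (inv s2 · s1) · (pow s2 (- j) · s1)                                ≈⟨ ∙-congʳ rel-1 ⟩
    (pow s1 i₁ · pow s2 j) · (pow s2 (- j) · s1)                       ≈⟨ solve 4 (λ a b c d → (a ⊕ b) ⊕ (c ⊕ d) ⊜ (a ⊕ (b ⊕ c)) ⊕ d)
                                                                            refl (pow s1 i₁) (pow s2 j) (pow s2 (- j)) s1 ⟩
    pow s1 i₁ · (pow s2 j · pow s2 (- j)) · s1                         ≈⟨ ∙-congʳ (trans (∙-congˡ (pow-inverseʳ s2 j)) (identityʳ _)) ⟩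
    pow s1 i₁ · s1                                                     ≈⟨ ∙-congˡ (identityʳ s1) ⟨
    pow s1 i₁ · pow s1 (+ 1)                                           ≈⟨ pow-+ s1 i₁ (+ 1) ⟨
    pow s1 (i₁ + + 1) ∎
    where
    σ₁¹⁻ⁱ²≈σ₁σ₁⁻ⁱ² : pow s1 (- (i₂ - + 1)) ≈ s1 · pow s1 (- i₂)
    σ₁¹⁻ⁱ²≈σ₁σ₁⁻ⁱ² = trans (reflexive (≡.cong (pow s1) (-[i-1]≡1-i i₂))) (pow-suc s1 (- i₂))
    σ₂⁻¹⁻¹≈σ₁ⁱ²σ₂⁻ʲσ₁ : inv (inv s2) ≈ pow s1 i₂ · pow s2 (- j) · s1
    σ₂⁻¹⁻¹≈σ₁ⁱ²σ₂⁻ʲσ₁ = trans (⁻¹-involutive s2) (trans (sym (//-rightDividesˡ s1 s2)) (∙-congʳ rel-2′))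

  conj-same : SameSubgroup (pow s1 (- (i₂ - + 1))) (pow s1 (i₁ + + 1))
  conj-same = conjugate⇒SameSubgroup m (- (i₂ - + 1)) (i₁ + + 1) rel-p σ₂⁻¹-conj

  sameSubgroup : SameSubgroup (pow s1 (i₁ + + 1)) (pow s1 (i₂ - + 1))
  sameSubgroup = SameSubgroup-trans (SameSubgroup-sym conj-same) (SameSubgroup-neg s1 (i₂ - + 1))

  normal-i₁+1 : NormalCyclic (pow s1 (i₁ + + 1))
  normal-i₁+1 = normalCyclic-byGenerators m n rel-p rel-q (pow-NormalizedBy s1 (i₁ + + 1))
    (IsSubmonoid.resp (NormalizedBy-isSubmonoid _) (⁻¹-involutive s2)
      (conjugate⇒NormalizedBy (conj-flip σ₂⁻¹-conj) (SameSubgroup-sym conj-same)))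

  normal-i₂-1 : NormalCyclic (pow s1 (i₂ - + 1))
  normal-i₂-1 = NormalCyclic-resp-Same sameSubgroup normal-i₁+1

proposition3p1 : (p q : ℕ) → 0 < p → 0 < q →
    ((i j₁ j₂ : ℤ) →
      Γ.SameSubgroup p q i j₁ (- i) j₂ (pow s2 (j₁ - + 1)) (pow s2 (j₂ + + 1))
      × Γ.NormalCyclic p q i j₁ (- i) j₂ (pow s2 (j₁ - + 1))
      × Γ.NormalCyclic p q i j₁ (- i) j₂ (pow s2 (j₂ + + 1)))
  × ((i₁ i₂ j : ℤ) →
      Γ.SameSubgroup p q i₁ j i₂ (- j) (pow s1 (i₁ + + 1)) (pow s1 (i₂ - + 1))
      × Γ.NormalCyclic p q i₁ j i₂ (- j) (pow s1 (i₁ + + 1))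
      × Γ.NormalCyclic p q i₁ j i₂ (- j) (pow s1 (i₂ - + 1)))
  × Γ.Tight p q -[1+ 0 ] (+ 1) (+ 1) -[1+ 0 ]
  × ((i : ℤ) → Γ.Tight p q i (+ 1) (- i) -[1+ 0 ])
  × ((i j₁ j₂ : ℤ) → Γ.Tight p q i j₁ (- i) j₂)
proposition3p1 (suc m) (suc n) _ _ =
    (λ i j₁ j₂ → let open Γ[i,j₁,-i,j₂] m n i j₁ j₂ in sameSubgroup , normal-j₁-1 , normal-j₂+1)
  , (λ i₁ i₂ j → let open Γ[i₁,j,i₂,-j] m n i₁ i₂ j in sameSubgroup , normal-i₁+1 , normal-i₂-1)
  , Γ[i,j₁,-i,j₂].tight m n -[1+ 0 ] (+ 1) -[1+ 0 ]
  , (λ i → Γ[i,j₁,-i,j₂].tight m n i (+ 1) -[1+ 0 ])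
  , Γ[i,j₁,-i,j₂].tight m n
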